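{- Let $G = \prod_{i=1}^t K_{n_i}$ with $2 \leq n_1 \leq \cdots \leq n_t$. If $t=2$, then $i(G) = n_1$. If $t=3$, then $i(G)=4$.
   Context: The vertices of the direct product $\prod_{i=1}^t K_{n_i}$ are the tuples in $\prod_{i=1}^t\{0,\dots,n_i-1\}$, adjacent iff they differ in every coordinate. The lower independence number $i(G)$ is the minimum size of a maximal (under inclusion) independent set of $G$. -}

module Defs where

open import Data.Nat using (ℕ; _≤_)
open import Data.Fin using (Fin)
open import Data.List using (List; []; _∷_; length)
open import Data.List.Membership.Propositional using (_∈_; _∉_)
open import Data.List.Relation.Unary.Unique.Propositional using (Unique)
open import Data.Product using (_×_; Σ; _,_)
open import Data.Unit using (⊤)
open import Relation.Binary.PropositionalEquality using (_≡_; _≢_)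
open import Relation.Nullary using (¬_)

Vertex : List ℕ → Set
Vertex []       = ⊤
Vertex (n ∷ ns) = Fin n × Vertex ns

Adj : (ns : List ℕ) → Vertex ns → Vertex ns → Set
Adj []       _       _       = ⊤
Adj (n ∷ ns) (a , x) (b , y) = (a ≢ b) × Adj ns x y

-- A finite vertex set, represented by a duplicate-free list of vertices; its size is the length.
-- Independent: no two members are adjacent.
Independent : (ns : List ℕ) → List (Vertex ns) → Set
Independent ns S = Unique S × (∀ {u v} → u ∈ S → v ∈ S → ¬ Adj ns u v)

MaximalIndependent : (ns : List ℕ) → List (Vertex ns) → Set
MaximalIndependent ns S =
  Independent ns S × (∀ v → v ∉ S → ¬ Independent ns (v ∷ S))

LowerIndependenceNumber : (ns : List ℕ) → ℕ → Set
LowerIndependenceNumber ns k =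
  Σ (List (Vertex ns)) (λ S → MaximalIndependent ns S × length S ≡ k)
  × (∀ S → MaximalIndependent ns S → k ≤ length S)

module Submission where

-- Two tuples of a direct product of complete graphs are non-adjacent exactly
-- when they agree in some coordinate, so independent sets are sets of pairwise
-- agreeing tuples.
--
-- t = 2: an independent set through (a , b) lies in row a or in column b; that
-- whole line is then forced into a maximal S, so |S| ≥ min(n₁, n₂) = n₁, and a
-- column is a maximal independent set with n₁ elements.
-- t = 3: three pairwise agreeing vertices have four distinct common agreers
-- (a coordinate plane, or a vertex together with its three one-coordinate
-- flips).  A maximal S with |S| ≤ 3 lies inside such a triple, so these four
-- vertices are forced into S, giving |S| ≥ 4.  The four 0/1 tuples of even
-- weight form a maximal independent set, verified by a finite decision.

open import Defs
open import Data.Nat using (ℕ; suc; _≤_; z≤n; s≤s)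
open import Data.Nat.Properties using (≤-trans)
open import Data.Fin using (Fin; zero; suc; _≟_)
open import Data.Fin.Patterns using (0F; 1F)
open import Data.List using (List; []; _∷_; length; map; allFin)
open import Data.List.Properties using (length-map; length-tabulate; length-removeAt′)
open import Data.List.Membership.Propositional using (_∈_; _∉_; _─_; find; lose)
open import Data.List.Membership.Propositional.Properties using (∈-map⁺; ∈-map⁻; ∈-allFin)
import Data.List.Membership.DecPropositional as DecMembership
open import Data.List.Relation.Binary.Subset.Propositional using (_⊆_)
open import Data.List.Relation.Unary.Any using (Any; here; there; index; any?)
open import Data.List.Relation.Unary.All as All using (All; []; _∷_; all?)
open import Data.List.Relation.Unary.All.Properties using (¬All⇒Any¬)
open import Data.List.Relation.Unary.AllPairs using ([]; _∷_)
open import Data.List.Relation.Unary.Unique.Propositional using (Unique)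
open import Data.List.Relation.Unary.Unique.Propositional.Properties using (map⁺; allFin⁺)
import Data.List.Relation.Unary.Unique.DecPropositional as DecUnique
open import Data.Product using (_×_; Σ; _,_; proj₁; proj₂)
open import Data.Product.Properties using (≡-dec)
open import Data.Sum using (_⊎_; inj₁; inj₂)
open import Data.Unit using (tt)
import Data.Unit.Properties as Unit
open import Data.Empty using (⊥-elim)
open import Function using (_∘_; id)
open import Relation.Nullary using (¬_; Dec; yes; no)
open import Relation.Nullary.Decidable using (¬?; _×-dec_; _⊎-dec_; map′; from-yes)
open import Relation.Binary.Definitions using (Decidable; DecidableEquality)
import Relation.Unary as U
open import Relation.Binary.PropositionalEquality using (_≡_; _≢_; refl; sym; trans; cong; subst; ≢-sym)

data Agree : (ns : List ℕ) → Vertex ns → Vertex ns → Set where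
  first : ∀ {n ns} {a : Fin n} {x y : Vertex ns} → Agree (n ∷ ns) (a , x) (a , y)
  later : ∀ {n ns} {a b : Fin n} {x y : Vertex ns} →
          Agree ns x y → Agree (n ∷ ns) (a , x) (b , y)

pattern at₁ = first
pattern at₂ = later first
pattern at₃ = later (later first)

agree⇒¬adj : ∀ {ns u v} → Agree ns u v → ¬ Adj ns u v
agree⇒¬adj first       (a≢a , _) = a≢a refl
agree⇒¬adj (later agr) (_ , adj) = agree⇒¬adj agr adj

¬adj⇒agree : ∀ ns {u v} → ¬ Adj ns u v → Agree ns u v
¬adj⇒agree []       non-adj = ⊥-elim (non-adj tt)
¬adj⇒agree (n ∷ ns) {a , x} {b , y} non-adj with a ≟ b
... | yes refl = first
... | no a≢b   = later (¬adj⇒agree ns (λ adj → non-adj (a≢b , adj)))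

agree-refl : ∀ {n ns} {v : Vertex (n ∷ ns)} → Agree (n ∷ ns) v v
agree-refl {v = _ , _} = first

agree-sym : ∀ {ns u v} → Agree ns u v → Agree ns v u
agree-sym first       = first
agree-sym (later agr) = later (agree-sym agr)

agreeing : ∀ {ns S u v} → Independent ns S → u ∈ S → v ∈ S → Agree ns u v
agreeing (_ , indep) u∈S v∈S = ¬adj⇒agree _ (indep u∈S v∈S)

_≟ᵥ_ : ∀ {ns} → DecidableEquality (Vertex ns)
_≟ᵥ_ {[]}     = Unit._≟_
_≟ᵥ_ {n ∷ ns} = ≡-dec _≟_ _≟ᵥ_

adj? : ∀ ns → Decidable (Adj ns)
adj? []       _       _       = yes tt
adj? (n ∷ ns) (a , x) (b , y) = ¬? (a ≟ b) ×-dec adj? ns x y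

_∈ᵥ?_ : ∀ {ns} → Decidable (_∈_ {A = Vertex ns})
_∈ᵥ?_ = DecMembership._∈?_ _≟ᵥ_

independent? : ∀ ns → U.Decidable (Independent ns)
independent? ns S =
  map′ (λ (distinct , checked) →
          distinct , λ u∈S v∈S → All.lookup (All.lookup checked u∈S) v∈S)
       (λ (distinct , indep) →
          distinct , All.tabulate (λ u∈S → All.tabulate (λ v∈S → indep u∈S v∈S)))
       (DecUnique.unique? _≟ᵥ_ S ×-dec all? (λ u → all? (λ v → ¬? (adj? ns u v)) S) S)

forced-member : ∀ {n ns S} → MaximalIndependent (n ∷ ns) S →
                ∀ v → (∀ {u} → u ∈ S → Agree (n ∷ ns) v u) → v ∈ S
forced-member {S = S} ((distinct , indep) , maximal) v agrees with v ∈ᵥ? S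
... | yes v∈S = v∈S
... | no v∉S  = ⊥-elim (maximal v v∉S (fresh ∷ distinct , indep′))
  where
  fresh : All (v ≢_) S
  fresh = All.tabulate (λ u∈S v≡u → v∉S (subst (_∈ S) (sym v≡u) u∈S))
  indep′ : ∀ {a b} → a ∈ v ∷ S → b ∈ v ∷ S → ¬ Adj _ a b
  indep′ (here refl) (here refl) = agree⇒¬adj agree-refl
  indep′ (here refl) (there b∈S) = agree⇒¬adj (agrees b∈S)
  indep′ (there a∈S) (here refl) = agree⇒¬adj (agree-sym (agrees a∈S))
  indep′ (there a∈S) (there b∈S) = indep a∈S b∈S

∈-─ : ∀ {A : Set} {x z : A} {ys} (x∈ys : x ∈ ys) → z ∈ ys → z ≢ x → z ∈ ys ─ x∈ys
∈-─ (here refl)  (here refl)  z≢x = ⊥-elim (z≢x refl)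
∈-─ (here _)     (there z∈ys) _   = z∈ys
∈-─ (there _)    (here refl)  _   = here refl
∈-─ (there x∈ys) (there z∈ys) z≢x = there (∈-─ x∈ys z∈ys z≢x)

pigeonhole : ∀ {A : Set} {xs ys : List A} → Unique xs → xs ⊆ ys → length xs ≤ length ys
pigeonhole {xs = []}              _                 _     = z≤n
pigeonhole {xs = x ∷ xs} {ys = ys} (x∉xs ∷ distinct) xs⊆ys =
  subst (suc (length xs) ≤_) (sym (length-removeAt′ ys (index x∈ys)))
        (s≤s (pigeonhole distinct rest⊆))
  where
  x∈ys = xs⊆ys (here refl)
  rest⊆ : xs ⊆ ys ─ x∈ys
  rest⊆ z∈xs = ∈-─ x∈ys (xs⊆ys (there z∈xs)) (≢-sym (All.lookup x∉xs z∈xs))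

forced-bound : ∀ {n ns S L} → MaximalIndependent (n ∷ ns) S → Unique L →
               (∀ {v u} → v ∈ L → u ∈ S → Agree (n ∷ ns) v u) → length L ≤ length S
forced-bound maximal distinct agrees =
  pigeonhole distinct (λ {v} v∈L → forced-member maximal v (agrees v∈L))

dominating⇒maximal : ∀ {ns S} → Independent ns S →
                     (∀ v → v ∈ S ⊎ Any (Adj ns v) S) → MaximalIndependent ns S
dominating⇒maximal {ns} {S} indep dominated = indep , no-extension
  where
  no-extension : ∀ v → v ∉ S → ¬ Independent ns (v ∷ S)
  no-extension v v∉S (_ , indep′) with dominated v
  ... | inj₁ v∈S = v∉S v∈S
  ... | inj₂ hit with find hit
  ...   | u , u∈S , v~u = indep′ (here refl) (there u∈S) v~u

≢-by : ∀ {A B : Set} (f : A → B) {x y} → f x ≢ f y → x ≢ y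
≢-by f fx≢fy x≡y = fx≢fy (cong f x≡y)

other : ∀ {m} → Fin (suc (suc m)) → Fin (suc (suc m))
other zero    = 1F
other (suc _) = 0F

other-≢ : ∀ {m} (x : Fin (suc (suc m))) → other x ≢ x
other-≢ zero    ()
other-≢ (suc _) ()

module TwoFactors (m₁ m₂ : ℕ) where

  ns : List ℕ
  ns = suc (suc m₁) ∷ suc (suc m₂) ∷ []

  V : Set
  V = Vertex ns

  InColumn : Fin (suc (suc m₂)) → V → Set
  InColumn b v = proj₁ (proj₂ v) ≡ b

  InRow : Fin (suc (suc m₁)) → V → Set
  InRow a v = proj₁ v ≡ a

  column : Fin (suc (suc m₂)) → List V
  column b = map (λ x → x , b , tt) (allFin (suc (suc m₁)))

  row : Fin (suc (suc m₁)) → List V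
  row a = map (λ y → a , y , tt) (allFin (suc (suc m₂)))

  column-size : ∀ b → length (column b) ≡ suc (suc m₁)
  column-size b = trans (length-map (λ x → x , b , tt) (allFin (suc (suc m₁))))
                        (length-tabulate {n = suc (suc m₁)} id)

  row-size : ∀ a → length (row a) ≡ suc (suc m₂)
  row-size a = trans (length-map (λ y → a , y , tt) (allFin (suc (suc m₂))))
                     (length-tabulate {n = suc (suc m₂)} id)

  column-distinct : ∀ b → Unique (column b)
  column-distinct b = map⁺ (cong proj₁) (allFin⁺ _)

  row-distinct : ∀ a → Unique (row a)
  row-distinct a = map⁺ (cong (proj₁ ∘ proj₂)) (allFin⁺ _)

  ∈-column : ∀ {x b} → (x , b , tt) ∈ column b
  ∈-column {x} = ∈-map⁺ _ (∈-allFin x)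

  column-members : ∀ {b v} → v ∈ column b → InColumn b v
  column-members v∈ with ∈-map⁻ _ v∈
  ... | _ , _ , refl = refl

  row-members : ∀ {a v} → v ∈ row a → InRow a v
  row-members v∈ with ∈-map⁻ _ v∈
  ... | _ , _ , refl = refl

  same-column : ∀ {b u v} → InColumn b u → InColumn b v → Agree ns u v
  same-column {u = _ , _ , tt} {v = _ , _ , tt} refl refl = at₂

  same-row : ∀ {a u v} → InRow a u → InRow a v → Agree ns u v
  same-row {u = _ , _ , tt} {v = _ , _ , tt} refl refl = at₁

  -- An independent set through (a , b) lies entirely in column b or in row a:
  -- a member w off column b shares row a with (a , b), and then a member off
  -- row a would have to share column b with (a , b) and the column of w.
  line-dichotomy : ∀ {S a b} → Independent ns S → (a , b , tt) ∈ S →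
                   All (InColumn b) S ⊎ All (InRow a) S
  line-dichotomy {S} {a} {b} indep p∈S with all? (λ w → proj₁ (proj₂ w) ≟ b) S
  ... | yes in-column = inj₁ in-column
  ... | no ¬in-column with find (¬All⇒Any¬ (λ w → proj₁ (proj₂ w) ≟ b) S ¬in-column)
  ...   | (w₁ , w₂ , tt) , w∈S , w₂≢b = inj₂ (All.tabulate in-row)
    where
    w₁≡a : w₁ ≡ a
    w₁≡a with agreeing indep w∈S p∈S
    ... | at₁ = refl
    ... | at₂ = ⊥-elim (w₂≢b refl)
    in-row : ∀ {e} → e ∈ S → InRow a e
    in-row {_ , _ , tt} e∈S with agreeing indep e∈S p∈S | agreeing indep e∈S w∈S
    ... | at₁ | _   = refl
    ... | at₂ | at₁ = w₁≡a
    ... | at₂ | at₂ = ⊥-elim (w₂≢b refl)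

  forced-column : ∀ {S b} → MaximalIndependent ns S → All (InColumn b) S →
                  suc (suc m₁) ≤ length S
  forced-column {S} {b} maximal in-column =
    subst (_≤ length S) (column-size b)
      (forced-bound maximal (column-distinct b)
        (λ v∈ u∈ → same-column (column-members v∈) (All.lookup in-column u∈)))

  forced-row : ∀ {S a} → MaximalIndependent ns S → All (InRow a) S →
               suc (suc m₂) ≤ length S
  forced-row {S} {a} maximal in-row =
    subst (_≤ length S) (row-size a)
      (forced-bound maximal (row-distinct a)
        (λ v∈ u∈ → same-row (row-members v∈) (All.lookup in-row u∈)))

  lower-bound : suc (suc m₁) ≤ suc (suc m₂) → ∀ S → MaximalIndependent ns S →
                suc (suc m₁) ≤ length S
  lower-bound _     []                    maximal = forced-column {b = 0F} maximal []
  lower-bound n₁≤n₂ ((a , b , tt) ∷ rest) maximal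
    with line-dichotomy (proj₁ maximal) (here refl)
  ... | inj₁ in-column = forced-column maximal in-column
  ... | inj₂ in-row    = ≤-trans n₁≤n₂ (forced-row maximal in-row)

  -- Column 0 is a maximal independent set: (x , b) with b ≠ 0 is adjacent to
  -- (other x , 0).
  column-maximal : MaximalIndependent ns (column 0F)
  column-maximal = dominating⇒maximal (column-distinct 0F , independent) dominated
    where
    independent : ∀ {u v} → u ∈ column 0F → v ∈ column 0F → ¬ Adj ns u v
    independent u∈ v∈ = agree⇒¬adj (same-column (column-members u∈) (column-members v∈))
    dominated : ∀ v → v ∈ column 0F ⊎ Any (Adj ns v) (column 0F)
    dominated (x , zero  , tt) = inj₁ ∈-column
    dominated (x , suc _ , tt) =
      inj₂ (lose (∈-column {other x}) (other-≢ x ∘ sym , (λ ()) , tt))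

module ThreeFactors (m₁ m₂ m₃ : ℕ) where

  ns : List ℕ
  ns = suc (suc m₁) ∷ suc (suc m₂) ∷ suc (suc m₃) ∷ []

  V : Set
  V = Vertex ns

  coord₁ : V → Fin (suc (suc m₁))
  coord₁ (x , _) = x

  coord₂ : V → Fin (suc (suc m₂))
  coord₂ (_ , y , _) = y

  coord₃ : V → Fin (suc (suc m₃))
  coord₃ (_ , _ , z , _) = z

  CommonAgreer : V → V → V → V → Set
  CommonAgreer s t u v = Agree ns v s × Agree ns v t × Agree ns v u

  FourCommonAgreers : V → V → V → Set
  FourCommonAgreers s t u =
    Σ (List V) λ L → Unique L × length L ≡ 4 × All (CommonAgreer s t u) L

  plane₁ : ∀ c {s₂ s₃ t₂ t₃ u₂ u₃} →
           FourCommonAgreers (c , s₂ , s₃ , tt) (c , t₂ , t₃ , tt) (c , u₂ , u₃ , tt)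
  plane₁ c =
    (c , 0F , 0F , tt) ∷ (c , 0F , 1F , tt) ∷ (c , 1F , 0F , tt) ∷ (c , 1F , 1F , tt) ∷ []
    , (≢-by coord₃ (λ ()) ∷ ≢-by coord₂ (λ ()) ∷ ≢-by coord₂ (λ ()) ∷ [])
      ∷ (≢-by coord₂ (λ ()) ∷ ≢-by coord₂ (λ ()) ∷ []) ∷ (≢-by coord₃ (λ ()) ∷ []) ∷ [] ∷ []
    , refl
    , (at₁ , at₁ , at₁) ∷ (at₁ , at₁ , at₁) ∷ (at₁ , at₁ , at₁) ∷ (at₁ , at₁ , at₁) ∷ []

  plane₂ : ∀ c {s₁ s₃ t₁ t₃ u₁ u₃} →
           FourCommonAgreers (s₁ , c , s₃ , tt) (t₁ , c , t₃ , tt) (u₁ , c , u₃ , tt)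
  plane₂ c =
    (0F , c , 0F , tt) ∷ (0F , c , 1F , tt) ∷ (1F , c , 0F , tt) ∷ (1F , c , 1F , tt) ∷ []
    , (≢-by coord₃ (λ ()) ∷ ≢-by coord₁ (λ ()) ∷ ≢-by coord₁ (λ ()) ∷ [])
      ∷ (≢-by coord₁ (λ ()) ∷ ≢-by coord₁ (λ ()) ∷ []) ∷ (≢-by coord₃ (λ ()) ∷ []) ∷ [] ∷ []
    , refl
    , (at₂ , at₂ , at₂) ∷ (at₂ , at₂ , at₂) ∷ (at₂ , at₂ , at₂) ∷ (at₂ , at₂ , at₂) ∷ []

  plane₃ : ∀ c {s₁ s₂ t₁ t₂ u₁ u₂} →
           FourCommonAgreers (s₁ , s₂ , c , tt) (t₁ , t₂ , c , tt) (u₁ , u₂ , c , tt)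
  plane₃ c =
    (0F , 0F , c , tt) ∷ (0F , 1F , c , tt) ∷ (1F , 0F , c , tt) ∷ (1F , 1F , c , tt) ∷ []
    , (≢-by coord₂ (λ ()) ∷ ≢-by coord₁ (λ ()) ∷ ≢-by coord₁ (λ ()) ∷ [])
      ∷ (≢-by coord₁ (λ ()) ∷ ≢-by coord₁ (λ ()) ∷ []) ∷ (≢-by coord₂ (λ ()) ∷ []) ∷ [] ∷ []
    , refl
    , (at₃ , at₃ , at₃) ∷ (at₃ , at₃ , at₃) ∷ (at₃ , at₃ , at₃) ∷ (at₃ , at₃ , at₃) ∷ []

  data AgreeTwice : V → V → Set where
    at₁₂ : ∀ {x₁ x₂ x₃ y₃} → AgreeTwice (x₁ , x₂ , x₃ , tt) (x₁ , x₂ , y₃ , tt)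
    at₁₃ : ∀ {x₁ x₂ x₃ y₂} → AgreeTwice (x₁ , x₂ , x₃ , tt) (x₁ , y₂ , x₃ , tt)
    at₂₃ : ∀ {x₁ x₂ x₃ y₁} → AgreeTwice (x₁ , x₂ , x₃ , tt) (y₁ , x₂ , x₃ , tt)

  star : V → List V
  star v@(x₁ , x₂ , x₃ , tt) =
    v ∷ (other x₁ , x₂ , x₃ , tt) ∷ (x₁ , other x₂ , x₃ , tt) ∷ (x₁ , x₂ , other x₃ , tt) ∷ []

  star-distinct : ∀ v → Unique (star v)
  star-distinct (x₁ , x₂ , x₃ , tt) =
    (≢-by coord₁ (other-≢ x₁ ∘ sym) ∷ ≢-by coord₂ (other-≢ x₂ ∘ sym)
      ∷ ≢-by coord₃ (other-≢ x₃ ∘ sym) ∷ [])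
    ∷ (≢-by coord₁ (other-≢ x₁) ∷ ≢-by coord₁ (other-≢ x₁) ∷ [])
    ∷ (≢-by coord₂ (other-≢ x₂) ∷ [])
    ∷ [] ∷ []

  star-agrees : ∀ {v s} → AgreeTwice v s → All (λ w → Agree ns w s) (star v)
  star-agrees at₁₂ = at₁ ∷ at₂ ∷ at₁ ∷ at₁ ∷ []
  star-agrees at₁₃ = at₁ ∷ at₃ ∷ at₁ ∷ at₁ ∷ []
  star-agrees at₂₃ = at₂ ∷ at₂ ∷ at₃ ∷ at₂ ∷ []

  star-common : ∀ {v s t u} → AgreeTwice v s → AgreeTwice v t → AgreeTwice v u →
                FourCommonAgreers s t u
  star-common {v} vs vt vu =
    star v , star-distinct v , refl
    , All.zip (star-agrees vs , All.zip (star-agrees vt , star-agrees vu))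

  -- Three pairwise agreeing vertices have four distinct common agreers: if two
  -- of the three agreements happen in the same coordinate all three vertices
  -- share it (a plane); otherwise the vertex collecting the three agreed values
  -- agrees twice with each of them (a star).
  four-common-agreers : ∀ {s t u} → Agree ns s t → Agree ns t u → Agree ns s u →
                        FourCommonAgreers s t u
  four-common-agreers at₁ at₁ _   = plane₁ _
  four-common-agreers at₁ _   at₁ = plane₁ _
  four-common-agreers _   at₁ at₁ = plane₁ _
  four-common-agreers at₂ at₂ _   = plane₂ _
  four-common-agreers at₂ _   at₂ = plane₂ _
  four-common-agreers _   at₂ at₂ = plane₂ _
  four-common-agreers at₃ at₃ _   = plane₃ _
  four-common-agreers at₃ _   at₃ = plane₃ _
  four-common-agreers _   at₃ at₃ = plane₃ _
  four-common-agreers at₁ at₂ at₃ = star-common at₁₃ at₁₂ at₂₃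
  four-common-agreers at₁ at₃ at₂ = star-common at₁₂ at₁₃ at₂₃
  four-common-agreers at₂ at₁ at₃ = star-common at₂₃ at₁₂ at₁₃
  four-common-agreers at₂ at₃ at₁ = star-common at₁₂ at₂₃ at₁₃
  four-common-agreers at₃ at₁ at₂ = star-common at₂₃ at₁₃ at₁₂
  four-common-agreers at₃ at₂ at₁ = star-common at₁₃ at₂₃ at₁₂

  triple-bound : ∀ {S s t u} → MaximalIndependent ns S →
                 Agree ns s t → Agree ns t u → Agree ns s u → S ⊆ s ∷ t ∷ u ∷ [] →
                 4 ≤ length S
  triple-bound {S} maximal st tu su S⊆stu with four-common-agreers st tu su
  ... | L , distinct , size , common =
    subst (_≤ length S) size (forced-bound maximal distinct agrees)
    where
    agrees : ∀ {v w} → v ∈ L → w ∈ S → Agree ns v w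
    agrees v∈L w∈S with All.lookup common v∈L | S⊆stu w∈S
    ... | vs , _  , _  | here refl                = vs
    ... | _  , vt , _  | there (here refl)        = vt
    ... | _  , _  , vu | there (there (here refl)) = vu

  -- Every maximal independent set has at least four elements: it is nonempty
  -- (the origin would be forced in), and with at most three members it lies
  -- inside the pairwise agreeing triple formed by them (repeated if needed).
  lower-bound : ∀ S → MaximalIndependent ns S → 4 ≤ length S
  lower-bound [] maximal with forced-member maximal (0F , 0F , 0F , tt) (λ ())
  ... | ()
  lower-bound (s ∷ []) maximal =
    triple-bound maximal agree-refl agree-refl agree-refl λ { (here refl) → here refl }
  lower-bound (s ∷ t ∷ []) maximal =
    triple-bound maximal st agree-refl st
      λ { (here refl) → here refl ; (there (here refl)) → there (here refl) }
    where
    st : Agree ns s t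
    st = agreeing (proj₁ maximal) (here refl) (there (here refl))
  lower-bound (s ∷ t ∷ u ∷ []) maximal =
    triple-bound maximal (agree (here refl) (there (here refl)))
      (agree (there (here refl)) (there (there (here refl))))
      (agree (here refl) (there (there (here refl)))) id
    where
    agree : ∀ {x y} → x ∈ s ∷ t ∷ u ∷ [] → y ∈ s ∷ t ∷ u ∷ [] → Agree ns x y
    agree = agreeing (proj₁ maximal)
  lower-bound (_ ∷ _ ∷ _ ∷ _ ∷ _) _ = s≤s (s≤s (s≤s (s≤s z≤n)))

  evenWeight : List V
  evenWeight =
    (0F , 0F , 0F , tt) ∷ (0F , 1F , 1F , tt) ∷ (1F , 0F , 1F , tt) ∷ (1F , 1F , 0F , tt) ∷ []

  domination? : ∀ v → Dec (v ∈ evenWeight ⊎ Any (Adj ns v) evenWeight)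
  domination? v = (v ∈ᵥ? evenWeight) ⊎-dec any? (adj? ns v) evenWeight

  pattern ≥2F = suc (suc _)

  -- Whether v is dominated by evenWeight depends only on whether each
  -- coordinate of v is 0, 1 or at least 2; each of the 27 cases is decided.
  dominated : ∀ v → v ∈ evenWeight ⊎ Any (Adj ns v) evenWeight
  dominated v@(0F  , 0F  , 0F  , tt) = from-yes (domination? v)
  dominated v@(0F  , 0F  , 1F  , tt) = from-yes (domination? v)
  dominated v@(0F  , 0F  , ≥2F , tt) = from-yes (domination? v)
  dominated v@(0F  , 1F  , 0F  , tt) = from-yes (domination? v)
  dominated v@(0F  , 1F  , 1F  , tt) = from-yes (domination? v)
  dominated v@(0F  , 1F  , ≥2F , tt) = from-yes (domination? v)
  dominated v@(0F  , ≥2F , 0F  , tt) = from-yes (domination? v)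
  dominated v@(0F  , ≥2F , 1F  , tt) = from-yes (domination? v)
  dominated v@(0F  , ≥2F , ≥2F , tt) = from-yes (domination? v)
  dominated v@(1F  , 0F  , 0F  , tt) = from-yes (domination? v)
  dominated v@(1F  , 0F  , 1F  , tt) = from-yes (domination? v)
  dominated v@(1F  , 0F  , ≥2F , tt) = from-yes (domination? v)
  dominated v@(1F  , 1F  , 0F  , tt) = from-yes (domination? v)
  dominated v@(1F  , 1F  , 1F  , tt) = from-yes (domination? v)
  dominated v@(1F  , 1F  , ≥2F , tt) = from-yes (domination? v)
  dominated v@(1F  , ≥2F , 0F  , tt) = from-yes (domination? v)
  dominated v@(1F  , ≥2F , 1F  , tt) = from-yes (domination? v)
  dominated v@(1F  , ≥2F , ≥2F , tt) = from-yes (domination? v)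
  dominated v@(≥2F , 0F  , 0F  , tt) = from-yes (domination? v)
  dominated v@(≥2F , 0F  , 1F  , tt) = from-yes (domination? v)
  dominated v@(≥2F , 0F  , ≥2F , tt) = from-yes (domination? v)
  dominated v@(≥2F , 1F  , 0F  , tt) = from-yes (domination? v)
  dominated v@(≥2F , 1F  , 1F  , tt) = from-yes (domination? v)
  dominated v@(≥2F , 1F  , ≥2F , tt) = from-yes (domination? v)
  dominated v@(≥2F , ≥2F , 0F  , tt) = from-yes (domination? v)
  dominated v@(≥2F , ≥2F , 1F  , tt) = from-yes (domination? v)
  dominated v@(≥2F , ≥2F , ≥2F , tt) = from-yes (domination? v)

  evenWeight-maximal : MaximalIndependent ns evenWeight
  evenWeight-maximal =
    dominating⇒maximal (from-yes (independent? ns evenWeight)) dominated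

theorem4p8 : (∀ (n₁ n₂ : ℕ) → 2 ≤ n₁ → n₁ ≤ n₂ →
      LowerIndependenceNumber (n₁ ∷ n₂ ∷ []) n₁)
    × (∀ (n₁ n₂ n₃ : ℕ) → 2 ≤ n₁ → n₁ ≤ n₂ → n₂ ≤ n₃ →
      LowerIndependenceNumber (n₁ ∷ n₂ ∷ n₃ ∷ []) 4)
theorem4p8 = two-factors , three-factors
  where
  two-factors : ∀ (n₁ n₂ : ℕ) → 2 ≤ n₁ → n₁ ≤ n₂ →
                LowerIndependenceNumber (n₁ ∷ n₂ ∷ []) n₁
  two-factors (suc (suc m₁)) (suc (suc m₂)) (s≤s (s≤s _)) n₁≤n₂@(s≤s (s≤s _)) =
    (column 0F , column-maximal , column-size 0F) , lower-bound n₁≤n₂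
    where open TwoFactors m₁ m₂
  three-factors : ∀ (n₁ n₂ n₃ : ℕ) → 2 ≤ n₁ → n₁ ≤ n₂ → n₂ ≤ n₃ →
                  LowerIndependenceNumber (n₁ ∷ n₂ ∷ n₃ ∷ []) 4
  three-factors (suc (suc m₁)) (suc (suc m₂)) (suc (suc m₃))
                (s≤s (s≤s _)) (s≤s (s≤s _)) (s≤s (s≤s _)) =
    (evenWeight , evenWeight-maximal , refl) , lower-bound
    where open ThreeFactors m₁ m₂ m₃
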